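{- Let $k\ge2$ and $n\ge3$ be integers. Then (1) $\mathrm{TC}_k$ is not a butterfly minor of $\mathrm{CC}_n$, and (2) $\mathrm{CC}_n$ is not a butterfly minor of $\mathrm{TC}_k$.
   Context: $\mathrm{CC}_n$: the undirected path $v_1\cdots v_n$ with each edge replaced by a directed cycle of length 2. $\mathrm{TC}_k$ (with terminals $s_k,t_k$): $\mathrm{TC}_0$ is a single vertex $v$ with $s_0=t_0=v$; $\mathrm{TC}_i$ is obtained from two disjoint copies $(B^1,s^1,t^1),(B^2,s^2,t^2)$ of $(\mathrm{TC}_{i-1},s_{i-1},t_{i-1})$ by adding edges $(s^1,t^2),(s^2,t^1)$ and setting $s_i=s^1$, $t_i=t^2$. An edge $(u,v)$ is butterfly contractible if it is the only edge with tail $u$ or the only edge with head $v$; butterfly contraction identifies $u,v$, redirecting incident edges and removing multiple edges. A butterfly minor is (isomorphic to) a digraph obtained by vertex deletions, edge deletions and butterfly contractions. -}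

module Defs where

open import Data.Nat using (ℕ; zero; suc; _+_)
open import Data.Fin using (Fin; zero; suc; toℕ; punchIn; punchOut; splitAt; _↑ˡ_; _↑ʳ_; _≟_)
open import Data.Sum using (_⊎_; inj₁; inj₂)
open import Data.Product using (Σ; _×_; _,_; ∃-syntax)
open import Data.Empty using (⊥)
open import Relation.Nullary using (¬_; yes; no)
open import Relation.Binary.PropositionalEquality using (_≡_; _≢_; sym)
open import Function.Bundles using (_⤖_; Bijection)

record Digraph : Set₁ where
  field
    V : ℕ
    E : Fin V → Fin V → Set
open Digraph public

_≅_ : Digraph → Digraph → Set
G ≅ H = Σ (Fin (V G) ⤖ Fin (V H)) λ f →
  ∀ x y → (E G x y → E H (Bijection.to f x) (Bijection.to f y))
        × (E H (Bijection.to f x) (Bijection.to f y) → E G x y)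

deleteVertex : (G : Digraph) {m : ℕ} → V G ≡ suc m → Fin (suc m) → Digraph
deleteVertex record { V = .(suc m) ; E = E } {m} _≡_.refl v =
  record { V = m ; E = λ a b → E (punchIn v a) (punchIn v b) }

deleteEdge : (G : Digraph) → Fin (V G) → Fin (V G) → Digraph
deleteEdge G x y = record { V = V G ; E = λ a b → E G a b × ¬ (a ≡ x × b ≡ y) }

ButterflyContractible : (G : Digraph) → Fin (V G) → Fin (V G) → Set
ButterflyContractible G u v =
  E G u v × ((∀ w → E G u w → w ≡ v) ⊎ (∀ w → E G w v → w ≡ u))

-- Merge map: identify v with u (v removed from the vertex set).
mergeMap : {m : ℕ} (u v : Fin (suc m)) → u ≢ v → Fin (suc m) → Fin m
mergeMap u v u≢v x with v ≟ x
... | yes _   = punchOut {i = v} {j = u} (λ e → u≢v (sym e))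
... | no v≢x  = punchOut {i = v} {j = x} v≢x

-- Contraction of (u , v): identify u and v; incident edges redirected,
-- parallel edges merged (relation), and loops removed.
contract : {m : ℕ} → (Fin (suc m) → Fin (suc m) → Set) →
           (u v : Fin (suc m)) → u ≢ v → Digraph
contract {m} E u v u≢v = record
  { V = m
  ; E = λ a b → (a ≢ b) × (∃[ x ] ∃[ y ] (E x y × mergeMap u v u≢v x ≡ a × mergeMap u v u≢v y ≡ b)) }

data _⟶*_ : Digraph → Digraph → Set₁ where
  done    : ∀ {G} → G ⟶* G
  delV    : ∀ {m} {E : Fin (suc m) → Fin (suc m) → Set} {H} (v : Fin (suc m)) →
            deleteVertex (record { V = suc m ; E = E }) _≡_.refl v ⟶* H →
            record { V = suc m ; E = E } ⟶* H
  delE    : ∀ {G H} (x y : Fin (V G)) → deleteEdge G x y ⟶* H → G ⟶* H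
  bcontr  : ∀ {m} {E : Fin (suc m) → Fin (suc m) → Set} {H} (u v : Fin (suc m)) (u≢v : u ≢ v) →
            ButterflyContractible (record { V = suc m ; E = E }) u v →
            contract E u v u≢v ⟶* H →
            record { V = suc m ; E = E } ⟶* H

ButterflyMinor : Digraph → Digraph → Set₁
ButterflyMinor H G = Σ Digraph λ G' → (G ⟶* G') × (G' ≅ H)

-- CC_n: path v_1 ... v_n with each edge a directed 2-cycle.
CC : ℕ → Digraph
CC n = record { V = n ; E = λ i j → (toℕ j ≡ suc (toℕ i)) ⊎ (toℕ i ≡ suc (toℕ j)) }

-- TC_k, with terminals s_k , t_k.
tcSize : ℕ → ℕ
tcSize zero    = 1
tcSize (suc k) = tcSize k + tcSize k

tcS : (k : ℕ) → Fin (tcSize k)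
tcS zero    = zero
tcS (suc k) = tcS k ↑ˡ tcSize k          -- s^1 (first copy)

tcT : (k : ℕ) → Fin (tcSize k)
tcT zero    = zero
tcT (suc k) = tcSize k ↑ʳ tcT k          -- t^2 (second copy)

tcE : (k : ℕ) → Fin (tcSize k) → Fin (tcSize k) → Set
tcE zero    _ _ = ⊥
tcE (suc k) a b = R (splitAt (tcSize k) a) (splitAt (tcSize k) b)
  where
  R : Fin (tcSize k) ⊎ Fin (tcSize k) → Fin (tcSize k) ⊎ Fin (tcSize k) → Set
  R (inj₁ x) (inj₁ y) = tcE k x y
  R (inj₂ x) (inj₂ y) = tcE k x y
  R (inj₁ x) (inj₂ y) = (x ≡ tcS k) × (y ≡ tcT k)
  R (inj₂ x) (inj₁ y) = (x ≡ tcS k) × (y ≡ tcT k)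

TC : ℕ → Digraph
TC k = record { V = tcSize k ; E = tcE k }

module Submission where

-- Both parts rest on vertex rankings (injections into ℕ) whose defining conditions survive
-- restriction along injections (vertex and edge deletion, isomorphism) and butterfly
-- contraction, where the contracted edge's surviving endpoint inherits the edges of the other.
-- (1) A forest ranking: every vertex has at most one neighbour of smaller rank. The path order
-- of CC_n is one, but no such ranking admits a 4-cycle, and TC_k (k ≥ 2) has the 4-cycle
-- s¹ t² s² t¹ in its underlying graph. Any contraction preserves it: keep the lower endpoint.
-- (2) A laminar ranking: backward edges join consecutive vertices and forward edges span
-- nested intervals. The natural order of TC_k is one, and contraction preserves it
-- because the contracted edge is the only one leaving its tail or entering its head. But in a
-- laminar ranking no vertex lies on two digons, while vertex v₂ of CC_n (n ≥ 3) does.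

open import Defs
open import Level using (0ℓ)
open import Data.Nat using (ℕ; zero; suc; _+_; _<_; _≤_; s≤s)
open import Data.Nat.Properties
  using (<-cmp; <-trans; <-≤-trans; ≤-<-trans; ≤-trans; ≤-refl; <⇒≤; <⇒≱; ≮⇒≥; <-irrefl; <-asym;
         n≮0; m<1+n⇒m≤n; m≤m+n; +-suc; +-identityʳ; +-cancelˡ-<; +-cancelˡ-≤; +-monoʳ-≤; suc-injective)
  renaming (≤∧≢⇒< to ℕ-≤∧≢⇒<)
open import Data.Fin using (Fin; zero; suc; toℕ; punchIn; splitAt; _↑ˡ_; _↑ʳ_; _≟_)
open import Data.Fin.Properties
  using (toℕ-injective; toℕ<n; toℕ-↑ˡ; toℕ-↑ʳ; ↑ˡ-injective; ↑ʳ-injective; splitAt-↑ˡ; splitAt-↑ʳ;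
         splitAt⁻¹-↑ˡ; splitAt⁻¹-↑ʳ; punchIn-injective; punchInᵢ≢i; punchIn-punchOut)
open import Data.Sum using (_⊎_; inj₁; inj₂; [_,_])
open import Data.Product using (_×_; _,_; proj₁; proj₂)
open import Data.Empty using (⊥; ⊥-elim)
open import Function using (id; _∘_)
open import Function.Bundles using (module Inverse)
open import Function.Definitions using (Injective)
open import Function.Properties.Bijection using (⤖⇒↔)
open import Relation.Binary.Core using (Rel; _⇒_; _=[_]⇒_)
open import Relation.Binary.Definitions using (Symmetric; tri<; tri≈; tri>)
open import Relation.Binary.Construct.Closure.Symmetric using (SymClosure; fwd; bwd; gmap; symmetric)
open import Relation.Binary.PropositionalEquality hiding ([_])
open import Relation.Nullary using (¬_; yes; no; contradiction)

record MinorClosed (P : ∀ {n} → Rel (Fin n) 0ℓ → Set) : Set₁ where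
  field
    restriction : ∀ {m n} {R : Rel (Fin n) 0ℓ} {S : Rel (Fin m) 0ℓ} (f : Fin m → Fin n) →
                  Injective _≡_ _≡_ f → S =[ f ]⇒ R → P R → P S
    contraction : ∀ {m} {R : Rel (Fin (suc m)) 0ℓ} (u v : Fin (suc m)) (u≢v : u ≢ v) →
                  ButterflyContractible (record { V = suc m ; E = R }) u v →
                  P R → P (E (contract R u v u≢v))

  ⟶*-preserves : ∀ {G H} → G ⟶* H → P (E G) → P (E H)
  ⟶*-preserves done                     = id
  ⟶*-preserves (delV v G⟶*H)            = ⟶*-preserves G⟶*H ∘ restriction (punchIn v) (punchIn-injective v _ _) id
  ⟶*-preserves (delE x y G⟶*H)          = ⟶*-preserves G⟶*H ∘ restriction id id proj₁
  ⟶*-preserves (bcontr u v u≢v bc G⟶*H) = ⟶*-preserves G⟶*H ∘ contraction u v u≢v bc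

  ≅-preserves : ∀ {G H} → G ≅ H → P (E G) → P (E H)
  ≅-preserves {G} {H} (bij , edges) = restriction from from-injective from-edge
    where
    open Inverse (⤖⇒↔ bij) using (to; from; strictlyInverseˡ)
    from-injective : Injective _≡_ _≡_ from
    from-injective {a} {b} eq = trans (sym (strictlyInverseˡ a)) (trans (cong to eq) (strictlyInverseˡ b))
    from-edge : E H =[ from ]⇒ E G
    from-edge {a} {b} e =
      proj₂ (edges (from a) (from b)) (subst₂ (E H) (sym (strictlyInverseˡ a)) (sym (strictlyInverseˡ b)) e)

  butterflyMinor-preserves : ∀ {G H} → ButterflyMinor H G → P (E G) → P (E H)
  butterflyMinor-preserves (G′ , G⟶*G′ , G′≅H) = ≅-preserves G′≅H ∘ ⟶*-preserves G⟶*G′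

data Merged {n} (R : Rel (Fin n) 0ℓ) (d k : Fin n) : Fin n → Fin n → Set where
  kept   : ∀ {a b} → R a b → a ≢ d → b ≢ d → Merged R d k a b
  from-d : ∀ {b} → R d b → b ≢ d → Merged R d k k b
  to-d   : ∀ {a} → R a d → a ≢ d → Merged R d k a k

SymClosure-Merged : ∀ {n} {R : Rel (Fin n) 0ℓ} {d k} → SymClosure (Merged R d k) ⇒ Merged (SymClosure R) d k
SymClosure-Merged (fwd (kept r a≢d b≢d)) = kept (fwd r) a≢d b≢d
SymClosure-Merged (fwd (from-d r b≢d))   = from-d (fwd r) b≢d
SymClosure-Merged (fwd (to-d r a≢d))     = to-d (fwd r) a≢d
SymClosure-Merged (bwd (kept r b≢d a≢d)) = kept (bwd r) a≢d b≢d
SymClosure-Merged (bwd (from-d r a≢d))   = to-d (bwd r) a≢d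
SymClosure-Merged (bwd (to-d r b≢d))     = from-d (bwd r) b≢d

Loopless : ∀ {n} → Rel (Fin n) 0ℓ → Rel (Fin n) 0ℓ
Loopless R a b = a ≢ b × R a b

-- embed identifies the vertices of the contraction with the old vertices other than d;
-- the merged vertex becomes k.
record CollapsingSection {m} (f : Fin (suc m) → Fin m) (d k : Fin (suc m)) : Set where
  field
    embed     : Fin m → Fin (suc m)
    f∘embed   : ∀ y → f (embed y) ≡ y
    embed∘f-d : embed (f d) ≡ k
    embed∘f   : ∀ {x} → x ≢ d → embed (f x) ≡ x
    k≢d       : k ≢ d

  embed-injective : Injective _≡_ _≡_ embed
  embed-injective {a} {b} eq = trans (sym (f∘embed a)) (trans (cong f eq) (f∘embed b))

  embed≢d : ∀ y → embed y ≢ d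
  embed≢d y embed-y≡d = k≢d (begin
    k                  ≡⟨ sym embed∘f-d ⟩
    embed (f d)        ≡⟨ cong (embed ∘ f) (sym embed-y≡d) ⟩
    embed (f (embed y)) ≡⟨ cong embed (f∘embed y) ⟩
    embed y            ≡⟨ embed-y≡d ⟩
    d                  ∎)
    where open ≡-Reasoning

  merged-edge : ∀ {R : Rel (Fin (suc m)) 0ℓ} {x y} → R x y → f x ≢ f y →
                Merged R d k (embed (f x)) (embed (f y))
  merged-edge {x = x} {y} r fx≢fy with x ≟ d | y ≟ d
  ... | yes refl | yes refl = contradiction refl fx≢fy
  ... | yes refl | no y≢d rewrite embed∘f-d | embed∘f y≢d = from-d r y≢d
  ... | no x≢d | yes refl rewrite embed∘f x≢d | embed∘f-d = to-d r x≢d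
  ... | no x≢d | no y≢d rewrite embed∘f x≢d | embed∘f y≢d = kept r x≢d y≢d

CollapsingSection-swap : ∀ {m} {f : Fin (suc m) → Fin m} {d k} → CollapsingSection f d k → f d ≡ f k → CollapsingSection f k d
CollapsingSection-swap {m} {f} {d} {k} S fd≡fk = record
  { embed     = embed′
  ; f∘embed   = f∘embed′
  ; embed∘f-d = embed′-k (trans (cong embed (sym fd≡fk)) embed∘f-d)
  ; embed∘f   = embed′∘f
  ; k≢d       = k≢d ∘ sym
  }
  where
  open CollapsingSection S
  embed′ : Fin m → Fin (suc m)
  embed′ y with embed y ≟ k
  ... | yes _ = d
  ... | no _  = embed y

  embed′-k : ∀ {y} → embed y ≡ k → embed′ y ≡ d
  embed′-k {y} eq with embed y ≟ k
  ... | yes _  = refl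
  ... | no neq = contradiction eq neq

  embed′-other : ∀ {y} → embed y ≢ k → embed′ y ≡ embed y
  embed′-other {y} neq with embed y ≟ k
  ... | yes eq = contradiction eq neq
  ... | no _   = refl

  f∘embed′ : ∀ y → f (embed′ y) ≡ y
  f∘embed′ y with embed y ≟ k
  ... | yes eq = trans fd≡fk (trans (cong f (sym eq)) (f∘embed y))
  ... | no _   = f∘embed y

  embed′∘f : ∀ {x} → x ≢ k → embed′ (f x) ≡ x
  embed′∘f {x} x≢k with x ≟ d
  ... | yes refl = embed′-k embed∘f-d
  ... | no x≢d   = trans (embed′-other (x≢k ∘ trans (sym (embed∘f x≢d)))) (embed∘f x≢d)

module _ {m} (u v : Fin (suc m)) (u≢v : u ≢ v) where
  private
    f : Fin (suc m) → Fin m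
    f = mergeMap u v u≢v

  punchIn-mergeMap-v : punchIn v (f v) ≡ u
  punchIn-mergeMap-v with v ≟ v
  ... | yes _   = punchIn-punchOut _
  ... | no v≢v  = contradiction refl v≢v

  punchIn-mergeMap : ∀ {x} → x ≢ v → punchIn v (f x) ≡ x
  punchIn-mergeMap {x} x≢v with v ≟ x
  ... | yes v≡x = contradiction (sym v≡x) x≢v
  ... | no _    = punchIn-punchOut _

  mergeMap-punchIn : ∀ y → f (punchIn v y) ≡ y
  mergeMap-punchIn y = punchIn-injective v _ _ (punchIn-mergeMap (punchInᵢ≢i v y))

  mergeMap-v≡u : f v ≡ f u
  mergeMap-v≡u = punchIn-injective v _ _ (trans punchIn-mergeMap-v (sym (punchIn-mergeMap u≢v)))

  keep-u : CollapsingSection f v u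
  keep-u = record
    { embed     = punchIn v
    ; f∘embed   = mergeMap-punchIn
    ; embed∘f-d = punchIn-mergeMap-v
    ; embed∘f   = punchIn-mergeMap
    ; k≢d       = u≢v
    }

  keep-v : CollapsingSection f u v
  keep-v = CollapsingSection-swap keep-u mergeMap-v≡u

contracted⇒merged : ∀ {m} {R : Rel (Fin (suc m)) 0ℓ} (u v : Fin (suc m)) (u≢v : u ≢ v) {d k}
                    (S : CollapsingSection (mergeMap u v u≢v) d k) →
                    E (contract R u v u≢v) =[ CollapsingSection.embed S ]⇒ Loopless (Merged R d k)
contracted⇒merged u v u≢v S (a≢b , x , y , r , refl , refl) = a≢b ∘ embed-injective , merged-edge r a≢b
  where open CollapsingSection S

record Ranking (n : ℕ) : Set where
  field
    rank           : Fin n → ℕ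
    rank-injective : Injective _≡_ _≡_ rank

  compare : ∀ {x y} → x ≢ y → rank x < rank y ⊎ rank y < rank x
  compare {x} {y} x≢y with <-cmp (rank x) (rank y)
  ... | tri< x<y _ _ = inj₁ x<y
  ... | tri≈ _ eq _  = contradiction (rank-injective eq) x≢y
  ... | tri> _ _ y<x = inj₂ y<x

  ≤∧≢⇒< : ∀ {x y} → rank x ≤ rank y → x ≢ y → rank x < rank y
  ≤∧≢⇒< x≤y x≢y = ℕ-≤∧≢⇒< x≤y (x≢y ∘ rank-injective)

  pullback : ∀ {m} (f : Fin m → Fin n) → Injective _≡_ _≡_ f → Ranking m
  pullback f f-injective = record { rank = rank ∘ f ; rank-injective = f-injective ∘ rank-injective }

toℕ-ranking : ∀ n → Ranking n
toℕ-ranking n = record { rank = toℕ ; rank-injective = toℕ-injective }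

LowerNeighbourUnique : ∀ {n} → Rel (Fin n) 0ℓ → (Fin n → ℕ) → Set
LowerNeighbourUnique A rank = ∀ {a b c} → A a b → A a c → rank b < rank a → rank c < rank a → b ≡ c

-- Such a ranking exists exactly when the underlying undirected graph is a forest (rank by depth).
record ForestRanking {n} (R : Rel (Fin n) 0ℓ) : Set where
  field
    ranking                : Ranking n
    lower-neighbour-unique : LowerNeighbourUnique (SymClosure R) (Ranking.rank ranking)
  open Ranking ranking public

module _ {n} (r : Ranking n) where
  open Ranking r

  Merged-lowerNeighbourUnique : ∀ {A : Rel (Fin n) 0ℓ} {d k} → Symmetric A → A d k → rank k < rank d →
                                LowerNeighbourUnique A rank → LowerNeighbourUnique (Merged A d k) rank
  Merged-lowerNeighbourUnique {A} {d} {k} A-sym dk k<d unique = merged-unique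
    where
    from-d-not-lower : ∀ {b} → A d b → rank b < rank k → ⊥
    from-d-not-lower db b<k = <-irrefl (cong rank (unique db dk (<-trans b<k k<d) k<d)) b<k

    to-d-not-beside-kept : ∀ {a c} → A a d → a ≢ d → A a c → c ≢ d → rank k < rank a → rank c < rank a → ⊥
    to-d-not-beside-kept ad a≢d ac c≢d k<a c<a with compare a≢d
    ... | inj₁ a<d = <-irrefl (cong rank (unique dk (A-sym ad) k<d a<d)) k<a
    ... | inj₂ d<a = c≢d (sym (unique ad ac d<a c<a))

    merged-unique : LowerNeighbourUnique (Merged A d k) rank
    merged-unique (kept ab _ _)  (kept ac _ _)   b<a c<a = unique ab ac b<a c<a
    merged-unique (from-d db _)  _               b<k _   = ⊥-elim (from-d-not-lower db b<k)
    merged-unique _              (from-d dc _)   _   c<k = ⊥-elim (from-d-not-lower dc c<k)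
    merged-unique (to-d _ _)     (to-d _ _)      _   _   = refl
    merged-unique (to-d ad a≢d)  (kept ac _ c≢d) k<a c<a = ⊥-elim (to-d-not-beside-kept ad a≢d ac c≢d k<a c<a)
    merged-unique (kept ab _ b≢d) (to-d ad a≢d)  b<a k<a = ⊥-elim (to-d-not-beside-kept ad a≢d ab b≢d k<a b<a)

  module _ {A : Rel (Fin n) 0ℓ} (A-sym : Symmetric A) (unique : LowerNeighbourUnique A rank) where

    -- x and y are the tops of their sides; the higher of the two has two lower neighbours.
    K₂₂-free-with-tops : ∀ {x x′ y y′} → A x y → A x y′ → A x′ y → x ≢ x′ → y ≢ y′ → x ≢ y →
                         rank x′ < rank x → rank y′ < rank y → ⊥
    K₂₂-free-with-tops xy xy′ x′y x≢x′ y≢y′ x≢y x′<x y′<y with compare x≢y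
    ... | inj₁ x<y = x≢x′ (unique (A-sym xy) (A-sym x′y) x<y (<-trans x′<x x<y))
    ... | inj₂ y<x = y≢y′ (unique xy xy′ y<x (<-trans y′<y y<x))

    K₂₂-free : ∀ {x x′ y y′} → A x y → A x y′ → A x′ y → A x′ y′ →
               x ≢ x′ → y ≢ y′ → x ≢ y → x ≢ y′ → x′ ≢ y → x′ ≢ y′ → ⊥
    K₂₂-free xy xy′ x′y x′y′ x≢x′ y≢y′ x≢y x≢y′ x′≢y x′≢y′ with compare x≢x′ | compare y≢y′
    ... | inj₂ x′<x | inj₂ y′<y = K₂₂-free-with-tops xy xy′ x′y x≢x′ y≢y′ x≢y x′<x y′<y
    ... | inj₂ x′<x | inj₁ y<y′ = K₂₂-free-with-tops xy′ xy x′y′ x≢x′ (y≢y′ ∘ sym) x≢y′ x′<x y<y′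
    ... | inj₁ x<x′ | inj₂ y′<y = K₂₂-free-with-tops x′y x′y′ xy (x≢x′ ∘ sym) y≢y′ x′≢y x<x′ y′<y
    ... | inj₁ x<x′ | inj₁ y<y′ = K₂₂-free-with-tops x′y′ x′y xy′ (x≢x′ ∘ sym) (y≢y′ ∘ sym) x′≢y′ x<x′ y<y′

ForestRanking-restrict : ∀ {m n} {R : Rel (Fin n) 0ℓ} {S : Rel (Fin m) 0ℓ} (f : Fin m → Fin n) →
                         Injective _≡_ _≡_ f → S =[ f ]⇒ R → ForestRanking R → ForestRanking S
ForestRanking-restrict f f-injective S⇒R F = record
  { ranking                = pullback f f-injective
  ; lower-neighbour-unique = λ ab ac b<a c<a →
      f-injective (lower-neighbour-unique (gmap f S⇒R ab) (gmap f S⇒R ac) b<a c<a)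
  }
  where open ForestRanking F

ForestRanking-Merged : ∀ {n} {R : Rel (Fin n) 0ℓ} {d k} (F : ForestRanking R) →
                       SymClosure R d k → ForestRanking.rank F k < ForestRanking.rank F d →
                       ForestRanking (Merged R d k)
ForestRanking-Merged {R = R} F dk k<d = record
  { ranking                = ranking
  ; lower-neighbour-unique = λ ab ac →
      Merged-lowerNeighbourUnique ranking (symmetric R) dk k<d lower-neighbour-unique
        (SymClosure-Merged ab) (SymClosure-Merged ac)
  }
  where open ForestRanking F

ForestRanking-contract : ∀ {m} {R : Rel (Fin (suc m)) 0ℓ} (u v : Fin (suc m)) (u≢v : u ≢ v) {d k} →
                         CollapsingSection (mergeMap u v u≢v) d k → (F : ForestRanking R) →
                         SymClosure R d k → ForestRanking.rank F k < ForestRanking.rank F d →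
                         ForestRanking (E (contract R u v u≢v))
ForestRanking-contract u v u≢v S F dk k<d =
  ForestRanking-restrict embed embed-injective (λ e → proj₂ (contracted⇒merged u v u≢v S e))
    (ForestRanking-Merged F dk k<d)
  where open CollapsingSection S

forestRanking-minorClosed : MinorClosed ForestRanking
forestRanking-minorClosed = record
  { restriction = ForestRanking-restrict
  ; contraction = λ u v u≢v (uv , _) F →
      [ ForestRanking-contract u v u≢v (keep-u u v u≢v) F (bwd uv)
      , ForestRanking-contract u v u≢v (keep-v u v u≢v) F (fwd uv)
      ] (ForestRanking.compare F u≢v)
  }

BackwardEdgesShort : ∀ {n} → Rel (Fin n) 0ℓ → (Fin n → ℕ) → Set
BackwardEdgesShort R rank = ∀ a b c → R a b → rank b < rank c → rank c < rank a → ⊥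

ForwardEdgesNested : ∀ {n} → Rel (Fin n) 0ℓ → (Fin n → ℕ) → Set
ForwardEdgesNested R rank =
  ∀ a b c e → R a b → R c e → rank a < rank c → rank c ≤ rank b → rank c < rank e → rank e ≤ rank b

record LaminarRanking {n} (R : Rel (Fin n) 0ℓ) : Set where
  field
    ranking              : Ranking n
    backward-edges-short : BackwardEdgesShort R (Ranking.rank ranking)
    forward-edges-nested : ForwardEdgesNested R (Ranking.rank ranking)
  open Ranking ranking public

  no-two-digons : ∀ {x y z} → R x y → R y x → R x z → R z x → x ≢ y → x ≢ z → y ≢ z → ⊥
  no-two-digons {x} {y} {z} xy yx xz zx x≢y x≢z y≢z with compare (x≢y ∘ sym) | compare (x≢z ∘ sym)
  ... | inj₁ y<x | inj₂ x<z = <⇒≱ x<z (forward-edges-nested y x x z yx xz y<x ≤-refl x<z)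
  ... | inj₂ x<y | inj₁ z<x = <⇒≱ x<y (forward-edges-nested z x x y zx xy z<x ≤-refl x<y)
  ... | inj₁ y<x | inj₁ z<x with compare y≢z
  ...   | inj₁ y<z = backward-edges-short x y z xy y<z z<x
  ...   | inj₂ z<y = backward-edges-short x z y xz z<y y<x
  no-two-digons {x} {y} {z} xy yx xz zx x≢y x≢z y≢z | inj₂ x<y | inj₂ x<z with compare y≢z
  ...   | inj₁ y<z = backward-edges-short z x y zx x<y y<z
  ...   | inj₂ z<y = backward-edges-short y x z yx x<z z<y

LaminarRanking-restrict : ∀ {m n} {R : Rel (Fin n) 0ℓ} {S : Rel (Fin m) 0ℓ} (f : Fin m → Fin n) →
                          Injective _≡_ _≡_ f → S =[ f ]⇒ R → LaminarRanking R → LaminarRanking S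
LaminarRanking-restrict f f-injective S⇒R L = record
  { ranking              = pullback f f-injective
  ; backward-edges-short = λ a b c ab → backward-edges-short (f a) (f b) (f c) (S⇒R ab)
  ; forward-edges-nested = λ a b c e ab ce → forward-edges-nested (f a) (f b) (f c) (f e) (S⇒R ab) (S⇒R ce)
  }
  where open LaminarRanking L

module MergeAlongUniqueOutEdge {n} {R : Rel (Fin n) 0ℓ} (L : LaminarRanking R) {d k : Fin n}
                               (k≢d : k ≢ d) (dk : R d k) (out-d : ∀ w → R d w → w ≡ k) where
  open LaminarRanking L renaming (backward-edges-short to short; forward-edges-nested to nested)

  backward-edges-short : ∀ a b c → c ≢ d → Loopless (Merged R d k) a b → rank b < rank c → rank c < rank a → ⊥
  backward-edges-short a b c c≢d (_ , kept ab _ _) b<c c<a = short a b c ab b<c c<a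
  backward-edges-short _ b c c≢d (k≢b , from-d db _) _ _ = k≢b (sym (out-d b db))
  backward-edges-short a _ c c≢d (_ , to-d ad a≢d) k<c c<a with compare (k≢d ∘ sym)
  ... | inj₁ d<k = short a d k ad d<k (<-trans k<c c<a)
  ... | inj₂ k<d with compare a≢d
  ...   | inj₁ a<d = short d k a dk (<-trans k<c c<a) a<d
  ...   | inj₂ d<a with compare c≢d
  ...     | inj₁ c<d = short d k c dk k<c c<d
  ...     | inj₂ d<c = short a d c ad d<c c<a

  nested-kept-to-d : ∀ {a b c} → R a b → a ≢ d → R c d → c ≢ d →
                     rank a < rank c → rank c ≤ rank b → rank c < rank k → rank k ≤ rank b
  nested-kept-to-d {a} {b} {c} ab a≢d cd c≢d a<c c≤b c<k with compare (k≢d ∘ sym)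
  ... | inj₂ k<d = ≤-trans (<⇒≤ k<d) (nested a b c d ab cd a<c c≤b (<-trans c<k k<d))
  ... | inj₁ d<k with compare c≢d
  ...   | inj₁ c<d = ⊥-elim (<⇒≱ d<k (nested c d d k cd dk c<d ≤-refl d<k))
  ...   | inj₂ d<c with compare a≢d
  ...     | inj₁ a<d = nested a b d k ab dk a<d (<⇒≤ (<-≤-trans d<c c≤b)) d<k
  ...     | inj₂ d<a = ⊥-elim (short c d a cd d<a a<c)

  nested-to-d-kept : ∀ {a c e} → R a d → a ≢ d → R c e → e ≢ d →
                     rank a < rank c → rank c ≤ rank k → rank c < rank e → rank e ≤ rank k
  nested-to-d-kept {a} {c} {e} ad a≢d ce e≢d a<c c≤k c<e with compare (k≢d ∘ sym)
  ... | inj₁ d<k with compare a≢d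
  ...   | inj₁ a<d = ⊥-elim (<⇒≱ d<k (nested a d d k ad dk a<d ≤-refl d<k))
  ...   | inj₂ d<a = nested d k c e dk ce (<-trans d<a a<c) c≤k c<e
  nested-to-d-kept {a} {c} {e} ad a≢d ce e≢d a<c c≤k c<e | inj₂ k<d =
    ≮⇒≥ (λ k<e → short d k e dk k<e e<d)
    where
    e<d : rank e < rank d
    e<d = ≤∧≢⇒< (nested a d c e ad ce a<c (<⇒≤ (≤-<-trans c≤k k<d)) c<e) e≢d

  forward-edges-nested : ForwardEdgesNested (Loopless (Merged R d k)) rank
  forward-edges-nested _ b _ _ (k≢b , from-d db _) _ _ _ _ = ⊥-elim (k≢b (sym (out-d b db)))
  forward-edges-nested _ _ _ e _ (k≢e , from-d de _) _ _ _ = ⊥-elim (k≢e (sym (out-d e de)))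
  forward-edges-nested a b c e (_ , kept ab _ _) (_ , kept ce _ _) = nested a b c e ab ce
  forward-edges-nested _ _ _ _ (_ , to-d _ _) (_ , to-d _ _) _ _ _ = ≤-refl
  forward-edges-nested _ _ _ _ (_ , kept ab a≢d _) (_ , to-d cd c≢d) = nested-kept-to-d ab a≢d cd c≢d
  forward-edges-nested _ _ _ _ (_ , to-d ad a≢d) (_ , kept ce _ e≢d) = nested-to-d-kept ad a≢d ce e≢d

module MergeAlongUniqueInEdge {n} {R : Rel (Fin n) 0ℓ} (L : LaminarRanking R) {d k : Fin n}
                              (k≢d : k ≢ d) (kd : R k d) (in-d : ∀ w → R w d → w ≡ k) where
  open LaminarRanking L renaming (backward-edges-short to short; forward-edges-nested to nested)

  backward-edges-short : ∀ a b c → c ≢ d → Loopless (Merged R d k) a b → rank b < rank c → rank c < rank a → ⊥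
  backward-edges-short a b c c≢d (_ , kept ab _ _) b<c c<a = short a b c ab b<c c<a
  backward-edges-short a _ c c≢d (a≢k , to-d ad _) _ _ = a≢k (in-d a ad)
  backward-edges-short _ b c c≢d (_ , from-d db b≢d) b<c c<k with compare k≢d
  ... | inj₁ k<d = short d b k db (<-trans b<c c<k) k<d
  ... | inj₂ d<k with compare (b≢d ∘ sym)
  ...   | inj₁ d<b = short k d b kd d<b (<-trans b<c c<k)
  ...   | inj₂ b<d with compare c≢d
  ...     | inj₁ c<d = short d b c db b<c c<d
  ...     | inj₂ d<c = short k d c kd d<c c<k

  nested-kept-from-d : ∀ {a b e} → R a b → a ≢ d → R d e → e ≢ d →
                       rank a < rank k → rank k ≤ rank b → rank k < rank e → rank e ≤ rank b
  nested-kept-from-d {a} {b} {e} ab a≢d de e≢d a<k k≤b k<e with compare (k≢d ∘ sym)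
  ... | inj₁ d<k with compare a≢d
  ...   | inj₁ a<d = nested a b d e ab de a<d (<⇒≤ (<-≤-trans d<k k≤b)) (<-trans d<k k<e)
  ...   | inj₂ d<a = ⊥-elim (short k d a kd d<a a<k)
  nested-kept-from-d {a} {b} {e} ab a≢d de e≢d a<k k≤b k<e | inj₂ k<d with compare e≢d
  ...   | inj₁ e<d = <⇒≤ (<-≤-trans e<d (nested a b k d ab kd a<k k≤b k<d))
  ...   | inj₂ d<e = ⊥-elim (<⇒≱ d<e (nested k d d e kd de k<d ≤-refl d<e))

  nested-from-d-kept : ∀ {b c e} → R d b → b ≢ d → R c e → e ≢ d →
                       rank k < rank c → rank c ≤ rank b → rank c < rank e → rank e ≤ rank b
  nested-from-d-kept {b} {c} {e} db b≢d ce e≢d k<c c≤b c<e with compare (k≢d ∘ sym)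
  ... | inj₁ d<k = nested d b c e db ce (<-trans d<k k<c) c≤b c<e
  ... | inj₂ k<d with compare b≢d
  ...   | inj₂ d<b = ⊥-elim (<⇒≱ d<b (nested k d d b kd db k<d ≤-refl d<b))
  ...   | inj₁ b<d = ≮⇒≥ (λ b<e → short d b e db b<e e<d)
    where
    e<d : rank e < rank d
    e<d = ≤∧≢⇒< (nested k d c e kd ce k<c (<⇒≤ (≤-<-trans c≤b b<d)) c<e) e≢d

  forward-edges-nested : ForwardEdgesNested (Loopless (Merged R d k)) rank
  forward-edges-nested a _ _ _ (a≢k , to-d ad _) _ _ _ _ = ⊥-elim (a≢k (in-d a ad))
  forward-edges-nested _ _ c _ _ (c≢k , to-d cd _) _ _ _ = ⊥-elim (c≢k (in-d c cd))
  forward-edges-nested a b c e (_ , kept ab _ _) (_ , kept ce _ _) = nested a b c e ab ce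
  forward-edges-nested _ _ _ _ (_ , from-d _ _) (_ , from-d _ _) k<k _ _ = ⊥-elim (<-irrefl refl k<k)
  forward-edges-nested _ _ _ _ (_ , kept ab a≢d _) (_ , from-d de e≢d) = nested-kept-from-d ab a≢d de e≢d
  forward-edges-nested _ _ _ _ (_ , from-d db b≢d) (_ , kept ce _ e≢d) = nested-from-d-kept db b≢d ce e≢d

LaminarRanking-contract : ∀ {m} {R : Rel (Fin (suc m)) 0ℓ} (u v : Fin (suc m)) (u≢v : u ≢ v) {d k} →
                          CollapsingSection (mergeMap u v u≢v) d k → (L : LaminarRanking R) →
                          (let open LaminarRanking L in
                            ∀ a b c → c ≢ d → Loopless (Merged R d k) a b → rank b < rank c → rank c < rank a → ⊥) →
                          ForwardEdgesNested (Loopless (Merged R d k)) (LaminarRanking.rank L) →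
                          LaminarRanking (E (contract R u v u≢v))
LaminarRanking-contract u v u≢v S L short nested = record
  { ranking              = pullback ranking embed embed-injective
  ; backward-edges-short = λ a b c ab →
      short (embed a) (embed b) (embed c) (embed≢d c) (contracted⇒merged u v u≢v S ab)
  ; forward-edges-nested = λ a b c e ab ce →
      nested (embed a) (embed b) (embed c) (embed e) (contracted⇒merged u v u≢v S ab) (contracted⇒merged u v u≢v S ce)
  }
  where
  open CollapsingSection S
  open LaminarRanking L using (ranking)
  open Ranking using (pullback)

laminarRanking-minorClosed : MinorClosed LaminarRanking
laminarRanking-minorClosed = record
  { restriction = LaminarRanking-restrict
  ; contraction = contraction
  }
  where
  contraction : ∀ {m} {R : Rel (Fin (suc m)) 0ℓ} (u v : Fin (suc m)) (u≢v : u ≢ v) →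
                ButterflyContractible (record { V = suc m ; E = R }) u v →
                LaminarRanking R → LaminarRanking (E (contract R u v u≢v))
  contraction u v u≢v (uv , inj₁ out-u) L =
    LaminarRanking-contract u v u≢v (keep-v u v u≢v) L backward-edges-short forward-edges-nested
    where open MergeAlongUniqueOutEdge L (u≢v ∘ sym) uv out-u
  contraction u v u≢v (uv , inj₂ in-v) L =
    LaminarRanking-contract u v u≢v (keep-u u v u≢v) L backward-edges-short forward-edges-nested
    where open MergeAlongUniqueInEdge L u≢v uv in-v

tcS-rank : ∀ k → toℕ (tcS k) ≡ 0
tcS-rank zero    = refl
tcS-rank (suc k) = trans (toℕ-↑ˡ (tcS k) (tcSize k)) (tcS-rank k)

tcT-rank : ∀ k → suc (toℕ (tcT k)) ≡ tcSize k
tcT-rank zero    = refl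
tcT-rank (suc k) = begin
  suc (toℕ (tcSize k ↑ʳ tcT k)) ≡⟨ cong suc (toℕ-↑ʳ (tcSize k) (tcT k)) ⟩
  suc (tcSize k + toℕ (tcT k))  ≡⟨ sym (+-suc (tcSize k) (toℕ (tcT k))) ⟩
  tcSize k + suc (toℕ (tcT k))  ≡⟨ cong (tcSize k +_) (tcT-rank k) ⟩
  tcSize k + tcSize k           ∎
  where open ≡-Reasoning

module Halves (h : ℕ) where

  data Half : Fin (h + h) → Set where
    left  : (i : Fin h) → Half (i ↑ˡ h)
    right : (j : Fin h) → Half (h ↑ʳ j)

  half : ∀ a → Half a
  half a with splitAt h a in eq
  ... | inj₁ i = subst Half (splitAt⁻¹-↑ˡ eq) (left i)
  ... | inj₂ j = subst Half (splitAt⁻¹-↑ʳ eq) (right j)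

  left<right : ∀ (i j : Fin h) → toℕ (i ↑ˡ h) < toℕ (h ↑ʳ j)
  left<right i j = subst₂ _<_ (sym (toℕ-↑ˡ i h)) (sym (toℕ-↑ʳ h j)) (<-≤-trans (toℕ<n i) (m≤m+n h (toℕ j)))

  left≢right : ∀ (i j : Fin h) → i ↑ˡ h ≢ h ↑ʳ j
  left≢right i j eq = <-irrefl (cong toℕ eq) (left<right i j)

  left-<⁻¹ : ∀ {i j : Fin h} → toℕ (i ↑ˡ h) < toℕ (j ↑ˡ h) → toℕ i < toℕ j
  left-<⁻¹ {i} {j} = subst₂ _<_ (toℕ-↑ˡ i h) (toℕ-↑ˡ j h)

  left-≤⁻¹ : ∀ {i j : Fin h} → toℕ (i ↑ˡ h) ≤ toℕ (j ↑ˡ h) → toℕ i ≤ toℕ j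
  left-≤⁻¹ {i} {j} = subst₂ _≤_ (toℕ-↑ˡ i h) (toℕ-↑ˡ j h)

  left-≤ : ∀ {i j : Fin h} → toℕ i ≤ toℕ j → toℕ (i ↑ˡ h) ≤ toℕ (j ↑ˡ h)
  left-≤ {i} {j} = subst₂ _≤_ (sym (toℕ-↑ˡ i h)) (sym (toℕ-↑ˡ j h))

  right-<⁻¹ : ∀ {i j : Fin h} → toℕ (h ↑ʳ i) < toℕ (h ↑ʳ j) → toℕ i < toℕ j
  right-<⁻¹ {i} {j} = +-cancelˡ-< h (toℕ i) (toℕ j) ∘ subst₂ _<_ (toℕ-↑ʳ h i) (toℕ-↑ʳ h j)

  right-≤⁻¹ : ∀ {i j : Fin h} → toℕ (h ↑ʳ i) ≤ toℕ (h ↑ʳ j) → toℕ i ≤ toℕ j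
  right-≤⁻¹ {i} {j} = +-cancelˡ-≤ h (toℕ i) (toℕ j) ∘ subst₂ _≤_ (toℕ-↑ʳ h i) (toℕ-↑ʳ h j)

  right-≤ : ∀ {i j : Fin h} → toℕ i ≤ toℕ j → toℕ (h ↑ʳ i) ≤ toℕ (h ↑ʳ j)
  right-≤ {i} {j} = subst₂ _≤_ (sym (toℕ-↑ʳ h i)) (sym (toℕ-↑ʳ h j)) ∘ +-monoʳ-≤ h

module TCEdges (k : ℕ) where
  open Halves (tcSize k)

  private
    h : ℕ
    h = tcSize k

  data TCEdge : Fin (tcSize (suc k)) → Fin (tcSize (suc k)) → Set where
    inLeft      : ∀ {i j} → tcE k i j → TCEdge (i ↑ˡ h) (j ↑ˡ h)
    inRight     : ∀ {i j} → tcE k i j → TCEdge (h ↑ʳ i) (h ↑ʳ j)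
    s¹→t² : TCEdge (tcS k ↑ˡ h) (h ↑ʳ tcT k)
    s²→t¹ : TCEdge (h ↑ʳ tcS k) (tcT k ↑ˡ h)

  tcS²-rank : toℕ (h ↑ʳ tcS k) ≡ h
  tcS²-rank = trans (toℕ-↑ʳ h (tcS k)) (trans (cong (h +_) (tcS-rank k)) (+-identityʳ h))

  tcT¹-rank : suc (toℕ (tcT k ↑ˡ h)) ≡ h
  tcT¹-rank = trans (cong suc (toℕ-↑ˡ (tcT k) h)) (tcT-rank k)

  tcEdge : ∀ {a b} → TCEdge a b → tcE (suc k) a b
  tcEdge (inLeft {i} {j} e)  rewrite splitAt-↑ˡ h i h | splitAt-↑ˡ h j h = e
  tcEdge (inRight {i} {j} e) rewrite splitAt-↑ʳ h h i | splitAt-↑ʳ h h j = e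
  tcEdge s¹→t² rewrite splitAt-↑ˡ h (tcS k) h | splitAt-↑ʳ h h (tcT k) = refl , refl
  tcEdge s²→t¹ rewrite splitAt-↑ʳ h h (tcS k) | splitAt-↑ˡ h (tcT k) h = refl , refl

  tcEdge-view : ∀ {a b} → tcE (suc k) a b → TCEdge a b
  tcEdge-view {a} {b} e with half a | half b
  ... | left i  | left j  rewrite splitAt-↑ˡ h i h | splitAt-↑ˡ h j h = inLeft e
  ... | right i | right j rewrite splitAt-↑ʳ h h i | splitAt-↑ʳ h h j = inRight e
  ... | left i  | right j rewrite splitAt-↑ˡ h i h | splitAt-↑ʳ h h j with e
  ...   | refl , refl = s¹→t²
  tcEdge-view e | right i | left j rewrite splitAt-↑ʳ h h i | splitAt-↑ˡ h j h with e
  ...   | refl , refl = s²→t¹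

tc-backward-edges-short : ∀ k → BackwardEdgesShort (tcE k) toℕ
tc-backward-edges-short zero    _ _ _ ()
tc-backward-edges-short (suc k) a b c ab = short (tcEdge-view ab) (half c)
  where
  open TCEdges k
  open Halves (tcSize k)
  short : ∀ {a b c} → TCEdge a b → Half c → toℕ b < toℕ c → toℕ c < toℕ a → ⊥
  short (inLeft ab)  (left l)  b<c c<a = tc-backward-edges-short k _ _ l ab (left-<⁻¹ b<c) (left-<⁻¹ c<a)
  short (inRight ab) (right l) b<c c<a = tc-backward-edges-short k _ _ l ab (right-<⁻¹ b<c) (right-<⁻¹ c<a)
  short (inLeft {i} _)      (right l) _   c<a = <-asym c<a (left<right i l)
  short (inRight {j = j} _) (left l)  b<c _   = <-asym b<c (left<right l j)
  short {c = c} s¹→t² _ _ c<s = n≮0 (subst (toℕ c <_) (tcS-rank (suc k)) c<s)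
  short {c = c} s²→t¹ _ t<c c<s =
    <⇒≱ (subst (toℕ c <_) tcS²-rank c<s) (subst (_≤ toℕ c) tcT¹-rank t<c)

tc-forward-edges-nested : ∀ k → ForwardEdgesNested (tcE k) toℕ
tc-forward-edges-nested zero    _ _ _ _ ()
tc-forward-edges-nested (suc k) a b c e ab ce = nested (tcEdge-view ab) (tcEdge-view ce)
  where
  open TCEdges k
  open Halves (tcSize k)
  nested : ∀ {a b c e} → TCEdge a b → TCEdge c e →
           toℕ a < toℕ c → toℕ c ≤ toℕ b → toℕ c < toℕ e → toℕ e ≤ toℕ b
  nested _ s²→t¹ _ _ c<e = ⊥-elim (<-asym c<e (left<right (tcT k) (tcS k)))
  nested s²→t¹ _ a<c c≤b _ = ⊥-elim (<-asym (<-≤-trans a<c c≤b) (left<right (tcT k) (tcS k)))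
  nested {a = a} _ s¹→t² a<s _ _ = ⊥-elim (n≮0 (subst (toℕ a <_) (tcS-rank (suc k)) a<s))
  nested {e = e} s¹→t² _ _ _ _ = m<1+n⇒m≤n (subst (toℕ e <_) (sym (tcT-rank (suc k))) (toℕ<n e))
  nested (inLeft ab) (inLeft ce) a<c c≤b c<e =
    left-≤ (tc-forward-edges-nested k _ _ _ _ ab ce (left-<⁻¹ a<c) (left-≤⁻¹ c≤b) (left-<⁻¹ c<e))
  nested (inRight ab) (inRight ce) a<c c≤b c<e =
    right-≤ (tc-forward-edges-nested k _ _ _ _ ab ce (right-<⁻¹ a<c) (right-≤⁻¹ c≤b) (right-<⁻¹ c<e))
  nested (inLeft {j = j} _) (inRight {i = l} _) _ c≤b _ = ⊥-elim (<⇒≱ (left<right j l) c≤b)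
  nested (inRight {i = i} _) (inLeft {i = l} _) a<c _ _ = ⊥-elim (<-asym a<c (left<right l i))

tc-laminar : ∀ k → LaminarRanking (tcE k)
tc-laminar k = record
  { ranking              = toℕ-ranking (tcSize k)
  ; backward-edges-short = tc-backward-edges-short k
  ; forward-edges-nested = tc-forward-edges-nested k
  }

tc-not-forest : ∀ k → ForestRanking (tcE (suc (suc k))) → ⊥
tc-not-forest k F =
  K₂₂-free ranking (symmetric _) lower-neighbour-unique
    (fwd (tcEdge s¹→t²)) (fwd (tcEdge (inLeft s→t))) (fwd (tcEdge (inRight s→t))) (fwd (tcEdge s²→t¹))
    (left≢right _ _) (left≢right _ _ ∘ sym) (left≢right _ _) (s≢t ∘ ↑ˡ-injective _ _ _)
    (s≢t ∘ ↑ʳ-injective _ _ _) (left≢right _ _ ∘ sym)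
  where
  open ForestRanking F
  open TCEdges (suc k)
  open Halves (tcSize (suc k))
  s→t : tcE (suc k) (tcS (suc k)) (tcT (suc k))
  s→t = TCEdges.tcEdge k TCEdges.s¹→t²
  s≢t : tcS (suc k) ≢ tcT (suc k)
  s≢t = Halves.left≢right (tcSize k) (tcS k) (tcT k)

cc-forest : ∀ n → ForestRanking (E (CC n))
cc-forest n = record { ranking = toℕ-ranking n ; lower-neighbour-unique = unique }
  where
  predecessor : ∀ {a b} → SymClosure (E (CC n)) a b → toℕ b < toℕ a → toℕ a ≡ suc (toℕ b)
  predecessor (fwd (inj₂ a≡1+b)) _ = a≡1+b
  predecessor (bwd (inj₁ a≡1+b)) _ = a≡1+b
  predecessor {a} (fwd (inj₁ b≡1+a)) b<a = ⊥-elim (<-asym b<a (subst (toℕ a <_) (sym b≡1+a) ≤-refl))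
  predecessor {a} (bwd (inj₂ b≡1+a)) b<a = ⊥-elim (<-asym b<a (subst (toℕ a <_) (sym b≡1+a) ≤-refl))
  unique : LowerNeighbourUnique (SymClosure (E (CC n))) toℕ
  unique ab ac b<a c<a = toℕ-injective (suc-injective (trans (sym (predecessor ab b<a)) (predecessor ac c<a)))

cc-not-laminar : ∀ n → LaminarRanking (E (CC (suc (suc (suc n))))) → ⊥
cc-not-laminar n L =
  no-two-digons {x = suc zero} {y = zero} {z = suc (suc zero)}
    (inj₂ refl) (inj₁ refl) (inj₁ refl) (inj₂ refl) (λ ()) (λ ()) (λ ())
  where open LaminarRanking L

lemma8p4 : (k n : ℕ) → 2 ≤ k → 3 ≤ n →
    (¬ ButterflyMinor (TC k) (CC n)) × (¬ ButterflyMinor (CC n) (TC k))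
lemma8p4 (suc (suc k)) (suc (suc (suc n))) (s≤s (s≤s _)) (s≤s (s≤s (s≤s _))) =
    (λ TC≼CC → tc-not-forest k (butterflyMinor-preserves forestRanking-minorClosed TC≼CC (cc-forest (suc (suc (suc n))))))
  , (λ CC≼TC → cc-not-laminar n (butterflyMinor-preserves laminarRanking-minorClosed CC≼TC (tc-laminar (suc (suc k)))))
  where open MinorClosed
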